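{- For all integers $n,j$ with $1\le j\le n$, $$\sum_{l=0}^{j-1}(-1)^{j-l-1}\binom{n-l-1}{n-j}\binom{n}{l}\frac{1}{n-l} = H_n-H_{n-j} = \frac{1}{(n)_j}\sum_{\nu=0}^{j-1}(-1)^{j-\nu-1}(\nu+1)\left[{j \atop \nu+1}\right]n^\nu.$$
   Context: $H_m=\sum_{i=1}^m \frac1i$ (with $H_0=0$). $(n)_j=n(n-1)\cdots(n-j+1)$ is the falling factorial ($(n)_0=1$). $\left[{j\atop k}\right]$ denotes the unsigned Stirling number of the first kind, defined by $(x)_j=\sum_{k=0}^j(-1)^{j-k}\left[{j\atop k}\right]x^k$. -}

module Defs where

open import Data.Nat as ℕ using (ℕ; zero; suc)
open import Data.Integer as ℤ using (ℤ)
open import Data.Rational using (ℚ; 0ℚ; 1ℚ; _+_; _*_; -_; _/_)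

-- reciprocal of a natural number as a rational; only used at nonzero arguments
-- (the value at 0 is an irrelevant junk value 0)
inv : ℕ → ℚ
inv zero    = 0ℚ
inv (suc m) = ℤ.+ 1 / suc m

ℕ→ℚ : ℕ → ℚ
ℕ→ℚ n = ℤ.+ n / 1

Σ< : ℕ → (ℕ → ℚ) → ℚ
Σ< zero    f = 0ℚ
Σ< (suc m) f = Σ< m f + f m

sgn : ℕ → ℚ
sgn zero    = 1ℚ
sgn (suc k) = - sgn k

H : ℕ → ℚ
H zero    = 0ℚ
H (suc m) = H m + inv (suc m)

falling : ℕ → ℕ → ℕ
falling n zero    = 1
falling n (suc j) = falling n j ℕ.* (n ℕ.∸ j)

-- unsigned Stirling numbers of the first kind [j k], via the recurrence
-- equivalent to (x)_{j+1} = (x)_j (x - j) and (x)_j = Σ (-1)^{j-k} [j k] x^k: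
-- [0 0] = 1, [0 (k+1)] = 0, [(j+1) 0] = 0, [(j+1) (k+1)] = j [j (k+1)] + [j k]
stirling1 : ℕ → ℕ → ℕ
stirling1 zero    zero    = 1
stirling1 zero    (suc k) = 0
stirling1 (suc j) zero    = 0
stirling1 (suc j) (suc k) = j ℕ.* stirling1 j (suc k) ℕ.+ stirling1 j k

-- Both expressions are compared with H n - H (n - j) = Σ_{i<j} 1/(n - i) by induction on j.
--
-- Binomial side: Pascal's rule on C(n-l-1, n-j-1) shows that passing from j to j+1 adds
-- Σ_{l≤j} (-1)^{j-l} C(n-l, n-j) C(n,l)/(n-l).  Absorption, C(n-l, n-j)/(n-l) = C(n-l-1, n-j-1)/(n-j),
-- turns this into 1/(n-j) times K_j = Σ_{l≤j} (-1)^{j-l} C(n,l) C(n-l-1, j-l), and K_j = 1 because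
-- by Pascal's rule again K_{j+1} - K_j = Σ_{l≤j+1} (-1)^{j+1-l} C(n,l) C(n-l, j+1-l)
-- = C(n,j+1) Σ_l (-1)^{j+1-l} C(j+1,l) = 0.
--
-- Stirling side: the sum is the derivative at x = n of (x)_j = Σ_ν (-1)^{j-ν} [j ν] x^ν, and
-- Σ_{i<j} 1/(x - i) is the logarithmic derivative of (x)_j.  The recurrence for [j ν] is
-- (x)_{j+1} = (x - j) (x)_j, and the product rule gives the matching recurrence for the derivative.

module Submission where

open import Defs
open import Data.Nat as ℕ using (ℕ; zero; suc; _≤_; _<_; _∸_; _^_; z≤n; s≤s; _!)
import Data.Nat.Properties as ℕ
open import Data.Nat.Combinatorics
  using (_C_; nCk+nC[k+1]≡[n+1]C[k+1]; k>n⇒nCk≡0; nCk≡n!/k![n-k]!; k![n∸k]!∣n!; nC1≡n; nCk≡nC[n∸k])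
open import Data.Nat.DivMod using (m/n*n≡m)
open import Data.Nat.Tactic.RingSolver using (solve-∀)
import Data.Nat.Coprimality as Coprimality
open import Data.Integer as ℤ using (+_)
import Data.Integer.Properties as ℤ
open import Data.Rational using (ℚ; mkℚ; _/_; _+_; _*_; _-_; -_; 0ℚ; 1ℚ)
open import Data.Rational.Properties
open import Data.Rational.Solver using (module +-*-Solver)
open +-*-Solver
open import Data.Product using (_×_; _,_)
open import Relation.Nullary using (yes; no)
open import Relation.Binary.PropositionalEquality
open ≡-Reasoning

n<m⇒m∸n≡suc[m∸suc[n]] : ∀ {m n} → n < m → m ∸ n ≡ suc (m ∸ suc n)
n<m⇒m∸n≡suc[m∸suc[n]] {suc m} {n} (s≤s n≤m) = ℕ.+-∸-assoc 1 n≤m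

m∸n∸1≡m∸suc[n] : ∀ m n → m ∸ n ∸ 1 ≡ m ∸ suc n
m∸n∸1≡m∸suc[n] m n = trans (ℕ.∸-+-assoc m n 1) (cong (m ∸_) (ℕ.+-comm n 1))

[n∸l]∸[r∸l]≡n∸r : ∀ {l r n} → l ≤ r → r ≤ n → (n ∸ l) ∸ (r ∸ l) ≡ n ∸ r
[n∸l]∸[r∸l]≡n∸r z≤n       _         = refl
[n∸l]∸[r∸l]≡n∸r (s≤s l≤r) (s≤s r≤n) = [n∸l]∸[r∸l]≡n∸r l≤r r≤n

ℕ→ℚ≡mkℚ : ∀ n → ℕ→ℚ n ≡ mkℚ (+ n) 0 (Coprimality.sym (Coprimality.1-coprimeTo n))
ℕ→ℚ≡mkℚ n = normalize-coprime _

ℕ→ℚ-+ : ∀ m n → ℕ→ℚ (m ℕ.+ n) ≡ ℕ→ℚ m + ℕ→ℚ n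
ℕ→ℚ-+ m n rewrite ℕ→ℚ≡mkℚ m | ℕ→ℚ≡mkℚ n =
  cong₂ (λ a b → (a ℤ.+ b) / 1) (sym (ℤ.*-identityʳ (+ m))) (sym (ℤ.*-identityʳ (+ n)))

ℕ→ℚ-* : ∀ m n → ℕ→ℚ (m ℕ.* n) ≡ ℕ→ℚ m * ℕ→ℚ n
ℕ→ℚ-* m n rewrite ℕ→ℚ≡mkℚ m | ℕ→ℚ≡mkℚ n = cong (_/ 1) (ℤ.pos-* m n)

ℕ→ℚ-∸ : ∀ {m n} → n ≤ m → ℕ→ℚ (m ∸ n) ≡ ℕ→ℚ m - ℕ→ℚ n
ℕ→ℚ-∸ {m} {n} n≤m = begin
  ℕ→ℚ (m ∸ n)                     ≡⟨ solve 2 (λ a b → a := (a :+ b) :- b) refl (ℕ→ℚ (m ∸ n)) (ℕ→ℚ n) ⟩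
  ℕ→ℚ (m ∸ n) + ℕ→ℚ n - ℕ→ℚ n     ≡⟨ cong (_- ℕ→ℚ n) (sym (ℕ→ℚ-+ (m ∸ n) n)) ⟩
  ℕ→ℚ (m ∸ n ℕ.+ n) - ℕ→ℚ n       ≡⟨ cong (λ k → ℕ→ℚ k - ℕ→ℚ n) (ℕ.m∸n+n≡m n≤m) ⟩
  ℕ→ℚ m - ℕ→ℚ n                   ∎

inv-inverseˡ : ∀ m → inv (suc m) * ℕ→ℚ (suc m) ≡ 1ℚ
inv-inverseˡ m rewrite normalize-coprime {1} {m} (Coprimality.1-coprimeTo (suc m)) | ℕ→ℚ≡mkℚ (suc m) =
  *-inverseˡ (mkℚ (+ suc m) 0 (Coprimality.sym (Coprimality.1-coprimeTo (suc m))))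

p*k≡q⇒p≡inv[k]*q : ∀ {k} p q → 0 < k → p * ℕ→ℚ k ≡ q → p ≡ inv k * q
p*k≡q⇒p≡inv[k]*q {suc k} p q _ pk≡q = begin
  p                                ≡⟨ sym (*-identityʳ p) ⟩
  p * 1ℚ                           ≡⟨ cong (p *_) (sym (inv-inverseˡ k)) ⟩
  p * (inv (suc k) * ℕ→ℚ (suc k))  ≡⟨ solve 3 (λ a i s → a :* (i :* s) := i :* (a :* s)) refl p (inv (suc k)) (ℕ→ℚ (suc k)) ⟩
  inv (suc k) * (p * ℕ→ℚ (suc k))  ≡⟨ cong (inv (suc k) *_) pk≡q ⟩
  inv (suc k) * q                  ∎

Σ<-cong : ∀ m {f g : ℕ → ℚ} → (∀ k → k < m → f k ≡ g k) → Σ< m f ≡ Σ< m g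
Σ<-cong zero    f≗g = refl
Σ<-cong (suc m) f≗g = cong₂ _+_ (Σ<-cong m (λ k k<m → f≗g k (ℕ.m<n⇒m<1+n k<m))) (f≗g m ℕ.≤-refl)

Σ<-distrib-+ : ∀ m (f g : ℕ → ℚ) → Σ< m (λ k → f k + g k) ≡ Σ< m f + Σ< m g
Σ<-distrib-+ zero    f g = refl
Σ<-distrib-+ (suc m) f g rewrite Σ<-distrib-+ m f g =
  solve 4 (λ a b c d → (a :+ b) :+ (c :+ d) := (a :+ c) :+ (b :+ d)) refl (Σ< m f) (Σ< m g) (f m) (g m)

*-distribˡ-Σ< : ∀ m c (f : ℕ → ℚ) → c * Σ< m f ≡ Σ< m (λ k → c * f k)
*-distribˡ-Σ< zero    c f = *-zeroʳ c
*-distribˡ-Σ< (suc m) c f rewrite sym (*-distribˡ-Σ< m c f) = *-distribˡ-+ c (Σ< m f) (f m)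

neg-distrib-Σ< : ∀ m (f : ℕ → ℚ) → - Σ< m f ≡ Σ< m (λ k → - f k)
neg-distrib-Σ< zero    f = refl
neg-distrib-Σ< (suc m) f rewrite sym (neg-distrib-Σ< m f) = neg-distrib-+ (Σ< m f) (f m)

Σ<-distrib-- : ∀ m (f g : ℕ → ℚ) → Σ< m (λ k → f k - g k) ≡ Σ< m f - Σ< m g
Σ<-distrib-- m f g = trans (Σ<-distrib-+ m f (λ k → - g k)) (cong (_+_ (Σ< m f)) (sym (neg-distrib-Σ< m g)))

Σ<-sucˡ : ∀ m (f : ℕ → ℚ) → Σ< (suc m) f ≡ f 0 + Σ< m (λ k → f (suc k))
Σ<-sucˡ zero    f = trans (+-identityˡ (f 0)) (sym (+-identityʳ (f 0)))
Σ<-sucˡ (suc m) f rewrite Σ<-sucˡ m f = +-assoc (f 0) _ _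

Σ<-suc-vanishing : ∀ m (f : ℕ → ℚ) → f m ≡ 0ℚ → Σ< (suc m) f ≡ Σ< m f
Σ<-suc-vanishing m f fm≡0 = trans (cong (_+_ (Σ< m f)) fm≡0) (+-identityʳ (Σ< m f))

sgn-suc-∸ : ∀ {m n} → n ≤ m → sgn (suc m ∸ n) ≡ - sgn (m ∸ n)
sgn-suc-∸ n≤m = cong sgn (ℕ.+-∸-assoc 1 n≤m)

sgn-n∸n : ∀ n → sgn (n ∸ n) ≡ 1ℚ
sgn-n∸n n = cong sgn (ℕ.n∸n≡0 n)

Σ<-sgn-flip : ∀ m (f : ℕ → ℚ) → Σ< m (λ l → sgn (m ∸ l) * f l) ≡ - Σ< m (λ l → sgn (m ∸ suc l) * f l)
Σ<-sgn-flip m f = begin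
  Σ< m (λ l → sgn (m ∸ l) * f l)          ≡⟨ Σ<-cong m flip ⟩
  Σ< m (λ l → - (sgn (m ∸ suc l) * f l))  ≡⟨ sym (neg-distrib-Σ< m _) ⟩
  - Σ< m (λ l → sgn (m ∸ suc l) * f l)    ∎
  where
  flip : ∀ l → l < m → sgn (m ∸ l) * f l ≡ - (sgn (m ∸ suc l) * f l)
  flip l l<m = trans (cong (λ k → sgn k * f l) (n<m⇒m∸n≡suc[m∸suc[n]] l<m)) (sym (neg-distribˡ-* (sgn (m ∸ suc l)) (f l)))

nCk*[k!*[n∸k]!]≡n! : ∀ {n k} → k ≤ n → (n C k) ℕ.* (k ! ℕ.* (n ∸ k) !) ≡ n !
nCk*[k!*[n∸k]!]≡n! {n} {k} k≤n =
  trans (cong (ℕ._* (k ! ℕ.* (n ∸ k) !)) (nCk≡n!/k![n-k]! k≤n))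
        (m/n*n≡m {{ℕ.m*n≢0 (k !) ((n ∸ k) !) {{ℕ._!≢0 k}} {{ℕ._!≢0 (n ∸ k)}}}} (k![n∸k]!∣n! k≤n))

nCl*[n∸l]C[r∸l]≡nCr*rCl : ∀ {l r n} → l ≤ r → r ≤ n → (n C l) ℕ.* ((n ∸ l) C (r ∸ l)) ≡ (n C r) ℕ.* (r C l)
nCl*[n∸l]C[r∸l]≡nCr*rCl {l} {r} {n} l≤r r≤n =
  ℕ.*-cancelʳ-≡ _ _ (l ! ℕ.* ((r ∸ l) ! ℕ.* (n ∸ r) !)) {{nonZero}} (trans lhs≡n! (sym rhs≡n!))
  where
  reorderˡ : ∀ a b c d e → a ℕ.* b ℕ.* (c ℕ.* (d ℕ.* e)) ≡ a ℕ.* (c ℕ.* (b ℕ.* (d ℕ.* e)))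
  reorderˡ = solve-∀
  reorderʳ : ∀ a b c d e → a ℕ.* b ℕ.* (c ℕ.* (d ℕ.* e)) ≡ a ℕ.* (b ℕ.* (c ℕ.* d) ℕ.* e)
  reorderʳ = solve-∀
  nonZero : ℕ.NonZero (l ! ℕ.* ((r ∸ l) ! ℕ.* (n ∸ r) !))
  nonZero = ℕ.m*n≢0 (l !) _ {{ℕ._!≢0 l}} {{ℕ.m*n≢0 ((r ∸ l) !) ((n ∸ r) !) {{ℕ._!≢0 (r ∸ l)}} {{ℕ._!≢0 (n ∸ r)}}}}
  lhs≡n! : (n C l) ℕ.* ((n ∸ l) C (r ∸ l)) ℕ.* (l ! ℕ.* ((r ∸ l) ! ℕ.* (n ∸ r) !)) ≡ n !
  lhs≡n! = begin
    (n C l) ℕ.* ((n ∸ l) C (r ∸ l)) ℕ.* (l ! ℕ.* ((r ∸ l) ! ℕ.* (n ∸ r) !))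
      ≡⟨ reorderˡ (n C l) ((n ∸ l) C (r ∸ l)) (l !) ((r ∸ l) !) ((n ∸ r) !) ⟩
    (n C l) ℕ.* (l ! ℕ.* (((n ∸ l) C (r ∸ l)) ℕ.* ((r ∸ l) ! ℕ.* (n ∸ r) !)))
      ≡⟨ cong (λ k → (n C l) ℕ.* (l ! ℕ.* (((n ∸ l) C (r ∸ l)) ℕ.* ((r ∸ l) ! ℕ.* k !)))) (sym ([n∸l]∸[r∸l]≡n∸r l≤r r≤n)) ⟩
    (n C l) ℕ.* (l ! ℕ.* (((n ∸ l) C (r ∸ l)) ℕ.* ((r ∸ l) ! ℕ.* ((n ∸ l) ∸ (r ∸ l)) !)))
      ≡⟨ cong (λ k → (n C l) ℕ.* (l ! ℕ.* k)) (nCk*[k!*[n∸k]!]≡n! (ℕ.∸-monoˡ-≤ l r≤n)) ⟩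
    (n C l) ℕ.* (l ! ℕ.* (n ∸ l) !)
      ≡⟨ nCk*[k!*[n∸k]!]≡n! (ℕ.≤-trans l≤r r≤n) ⟩
    n ! ∎
  rhs≡n! : (n C r) ℕ.* (r C l) ℕ.* (l ! ℕ.* ((r ∸ l) ! ℕ.* (n ∸ r) !)) ≡ n !
  rhs≡n! = begin
    (n C r) ℕ.* (r C l) ℕ.* (l ! ℕ.* ((r ∸ l) ! ℕ.* (n ∸ r) !))
      ≡⟨ reorderʳ (n C r) (r C l) (l !) ((r ∸ l) !) ((n ∸ r) !) ⟩
    (n C r) ℕ.* ((r C l) ℕ.* (l ! ℕ.* (r ∸ l) !) ℕ.* (n ∸ r) !)
      ≡⟨ cong (λ k → (n C r) ℕ.* (k ℕ.* (n ∸ r) !)) (nCk*[k!*[n∸k]!]≡n! l≤r) ⟩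
    (n C r) ℕ.* (r ! ℕ.* (n ∸ r) !)
      ≡⟨ nCk*[k!*[n∸k]!]≡n! r≤n ⟩
    n ! ∎

[1+t]C[1+m]*[1+m]≡[1+t]*tCm : ∀ {t m} → m ≤ t → (suc t C suc m) ℕ.* suc m ≡ suc t ℕ.* (t C m)
[1+t]C[1+m]*[1+m]≡[1+t]*tCm {t} {m} m≤t = begin
  (suc t C suc m) ℕ.* suc m          ≡⟨ cong ((suc t C suc m) ℕ.*_) (sym (nC1≡n (suc m))) ⟩
  (suc t C suc m) ℕ.* (suc m C 1)    ≡⟨ sym (nCl*[n∸l]C[r∸l]≡nCr*rCl (s≤s z≤n) (s≤s m≤t)) ⟩
  (suc t C 1) ℕ.* (t C m)            ≡⟨ cong (ℕ._* (t C m)) (nC1≡n (suc t)) ⟩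
  suc t ℕ.* (t C m)                  ∎

ℕ→ℚ-pascal : ∀ T r → ℕ→ℚ (T C r) + ℕ→ℚ (T C suc r) ≡ ℕ→ℚ (suc T C suc r)
ℕ→ℚ-pascal T r = trans (sym (ℕ→ℚ-+ (T C r) (T C suc r))) (cong ℕ→ℚ (nCk+nC[k+1]≡[n+1]C[k+1] T r))

ℕ→ℚ-absorption : ∀ {t m} → m ≤ t → ℕ→ℚ (suc t C suc m) * inv (suc t) ≡ inv (suc m) * ℕ→ℚ (t C m)
ℕ→ℚ-absorption {t} {m} m≤t = p*k≡q⇒p≡inv[k]*q {suc m} _ _ (s≤s z≤n) (begin
  ℕ→ℚ (suc t C suc m) * inv (suc t) * ℕ→ℚ (suc m)
    ≡⟨ solve 3 (λ a i b → a :* i :* b := a :* b :* i) refl (ℕ→ℚ (suc t C suc m)) (inv (suc t)) (ℕ→ℚ (suc m)) ⟩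
  ℕ→ℚ (suc t C suc m) * ℕ→ℚ (suc m) * inv (suc t)
    ≡⟨ cong (_* inv (suc t)) (sym (ℕ→ℚ-* (suc t C suc m) (suc m))) ⟩
  ℕ→ℚ ((suc t C suc m) ℕ.* suc m) * inv (suc t)
    ≡⟨ cong (λ k → ℕ→ℚ k * inv (suc t)) ([1+t]C[1+m]*[1+m]≡[1+t]*tCm m≤t) ⟩
  ℕ→ℚ (suc t ℕ.* (t C m)) * inv (suc t)
    ≡⟨ cong (_* inv (suc t)) (ℕ→ℚ-* (suc t) (t C m)) ⟩
  ℕ→ℚ (suc t) * ℕ→ℚ (t C m) * inv (suc t)
    ≡⟨ solve 3 (λ s c i → s :* c :* i := c :* (i :* s)) refl (ℕ→ℚ (suc t)) (ℕ→ℚ (t C m)) (inv (suc t)) ⟩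
  ℕ→ℚ (t C m) * (inv (suc t) * ℕ→ℚ (suc t))
    ≡⟨ cong (ℕ→ℚ (t C m) *_) (inv-inverseˡ t) ⟩
  ℕ→ℚ (t C m) * 1ℚ
    ≡⟨ *-identityʳ (ℕ→ℚ (t C m)) ⟩
  ℕ→ℚ (t C m) ∎)

Σ<-alternating-C : ∀ N j → Σ< (suc j) (λ l → sgn (j ∸ l) * ℕ→ℚ (suc N C l)) ≡ ℕ→ℚ (N C j)
Σ<-alternating-C N zero    = refl
Σ<-alternating-C N (suc j) = begin
  Σ< (suc j) (λ l → sgn (suc j ∸ l) * ℕ→ℚ (suc N C l)) + sgn (suc j ∸ suc j) * ℕ→ℚ (suc N C suc j)
    ≡⟨ cong₂ _+_ (Σ<-sgn-flip (suc j) (λ l → ℕ→ℚ (suc N C l))) (cong (_* ℕ→ℚ (suc N C suc j)) (sgn-n∸n j)) ⟩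
  - Σ< (suc j) (λ l → sgn (j ∸ l) * ℕ→ℚ (suc N C l)) + 1ℚ * ℕ→ℚ (suc N C suc j)
    ≡⟨ cong₂ (λ a b → - a + b) (Σ<-alternating-C N j) (trans (*-identityˡ _) (sym (ℕ→ℚ-pascal N j))) ⟩
  - ℕ→ℚ (N C j) + (ℕ→ℚ (N C j) + ℕ→ℚ (N C suc j))
    ≡⟨ solve 2 (λ a b → :- a :+ (a :+ b) := b) refl (ℕ→ℚ (N C j)) (ℕ→ℚ (N C suc j)) ⟩
  ℕ→ℚ (N C suc j) ∎

-- The binomial sum

[n∸o]∸[n∸m]≡m∸o : ∀ {o m n} → o ≤ m → m ≤ n → (n ∸ o) ∸ (n ∸ m) ≡ m ∸ o
[n∸o]∸[n∸m]≡m∸o z≤n       m≤n       = ℕ.m∸[m∸n]≡n m≤n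
[n∸o]∸[n∸m]≡m∸o (s≤s o≤m) (s≤s m≤n) = [n∸o]∸[n∸m]≡m∸o o≤m m≤n

ℕ→ℚ-absorption-∸ : ∀ {n l j} → l ≤ j → j < n →
  ℕ→ℚ ((n ∸ l) C (n ∸ j)) * inv (n ∸ l) ≡ inv (n ∸ j) * ℕ→ℚ ((n ∸ suc l) C (j ∸ l))
ℕ→ℚ-absorption-∸ {n} {l} {j} l≤j j<n
  rewrite n<m⇒m∸n≡suc[m∸suc[n]] (ℕ.≤-<-trans l≤j j<n) | n<m⇒m∸n≡suc[m∸suc[n]] j<n =
  trans (ℕ→ℚ-absorption M≤T) (cong (λ k → inv (suc (n ∸ suc j)) * ℕ→ℚ k) symmetry)
  where
  M≤T : n ∸ suc j ≤ n ∸ suc l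
  M≤T = ℕ.∸-monoʳ-≤ n (s≤s l≤j)
  symmetry : (n ∸ suc l) C (n ∸ suc j) ≡ (n ∸ suc l) C (j ∸ l)
  symmetry = trans (nCk≡nC[n∸k] M≤T) (cong ((n ∸ suc l) C_) ([n∸o]∸[n∸m]≡m∸o (s≤s l≤j) j<n))

Σ<-sgn*C*C≡0 : ∀ n r → suc r ≤ n →
  Σ< (suc (suc r)) (λ l → sgn (suc r ∸ l) * (ℕ→ℚ (n C l) * ℕ→ℚ ((n ∸ l) C (suc r ∸ l)))) ≡ 0ℚ
Σ<-sgn*C*C≡0 n r sr≤n = begin
  Σ< (suc (suc r)) (λ l → sgn (suc r ∸ l) * (ℕ→ℚ (n C l) * ℕ→ℚ ((n ∸ l) C (suc r ∸ l))))
    ≡⟨ Σ<-cong (suc (suc r)) (λ l l<2+r → factor l (ℕ.≤-pred l<2+r)) ⟩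
  Σ< (suc (suc r)) (λ l → ℕ→ℚ (n C suc r) * (sgn (suc r ∸ l) * ℕ→ℚ (suc r C l)))
    ≡⟨ sym (*-distribˡ-Σ< (suc (suc r)) (ℕ→ℚ (n C suc r)) _) ⟩
  ℕ→ℚ (n C suc r) * Σ< (suc (suc r)) (λ l → sgn (suc r ∸ l) * ℕ→ℚ (suc r C l))
    ≡⟨ cong (ℕ→ℚ (n C suc r) *_) (Σ<-alternating-C r (suc r)) ⟩
  ℕ→ℚ (n C suc r) * ℕ→ℚ (r C suc r)
    ≡⟨ cong (λ k → ℕ→ℚ (n C suc r) * ℕ→ℚ k) (k>n⇒nCk≡0 (ℕ.n<1+n r)) ⟩
  ℕ→ℚ (n C suc r) * 0ℚ
    ≡⟨ *-zeroʳ (ℕ→ℚ (n C suc r)) ⟩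
  0ℚ ∎
  where
  factor : ∀ l → l ≤ suc r →
    sgn (suc r ∸ l) * (ℕ→ℚ (n C l) * ℕ→ℚ ((n ∸ l) C (suc r ∸ l))) ≡ ℕ→ℚ (n C suc r) * (sgn (suc r ∸ l) * ℕ→ℚ (suc r C l))
  factor l l≤1+r = begin
    sgn (suc r ∸ l) * (ℕ→ℚ (n C l) * ℕ→ℚ ((n ∸ l) C (suc r ∸ l)))
      ≡⟨ cong (sgn (suc r ∸ l) *_) (sym (ℕ→ℚ-* (n C l) ((n ∸ l) C (suc r ∸ l)))) ⟩
    sgn (suc r ∸ l) * ℕ→ℚ ((n C l) ℕ.* ((n ∸ l) C (suc r ∸ l)))
      ≡⟨ cong (λ k → sgn (suc r ∸ l) * ℕ→ℚ k) (nCl*[n∸l]C[r∸l]≡nCr*rCl l≤1+r sr≤n) ⟩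
    sgn (suc r ∸ l) * ℕ→ℚ ((n C suc r) ℕ.* (suc r C l))
      ≡⟨ cong (sgn (suc r ∸ l) *_) (ℕ→ℚ-* (n C suc r) (suc r C l)) ⟩
    sgn (suc r ∸ l) * (ℕ→ℚ (n C suc r) * ℕ→ℚ (suc r C l))
      ≡⟨ solve 3 (λ s a b → s :* (a :* b) := a :* (s :* b)) refl (sgn (suc r ∸ l)) (ℕ→ℚ (n C suc r)) (ℕ→ℚ (suc r C l)) ⟩
    ℕ→ℚ (n C suc r) * (sgn (suc r ∸ l) * ℕ→ℚ (suc r C l)) ∎

Σ<-sgn*C*C≡1 : ∀ n j → j < n →
  Σ< (suc j) (λ l → sgn (j ∸ l) * (ℕ→ℚ (n C l) * ℕ→ℚ ((n ∸ suc l) C (j ∸ l)))) ≡ 1ℚ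
Σ<-sgn*C*C≡1 n zero    _     = refl
Σ<-sgn*C*C≡1 n (suc j) 1+j<n = begin
  Σ< (suc j) (term (suc j)) + term (suc j) (suc j)
    ≡⟨ cong₂ _+_ (Σ<-cong (suc j) (λ l l<1+j → pascal l (ℕ.≤-pred l<1+j))) last-term ⟩
  Σ< (suc j) (λ l → vanishing l + term j l) + vanishing (suc j)
    ≡⟨ cong (_+ vanishing (suc j)) (Σ<-distrib-+ (suc j) vanishing (term j)) ⟩
  Σ< (suc j) vanishing + Σ< (suc j) (term j) + vanishing (suc j)
    ≡⟨ solve 3 (λ a b c → a :+ b :+ c := (a :+ c) :+ b) refl (Σ< (suc j) vanishing) (Σ< (suc j) (term j)) (vanishing (suc j)) ⟩
  Σ< (suc (suc j)) vanishing + Σ< (suc j) (term j)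
    ≡⟨ cong₂ _+_ (Σ<-sgn*C*C≡0 n j (ℕ.<⇒≤ 1+j<n)) (Σ<-sgn*C*C≡1 n j (ℕ.<-trans (ℕ.n<1+n j) 1+j<n)) ⟩
  0ℚ + 1ℚ
    ≡⟨ +-identityˡ 1ℚ ⟩
  1ℚ ∎
  where
  term : ℕ → ℕ → ℚ
  term i l = sgn (i ∸ l) * (ℕ→ℚ (n C l) * ℕ→ℚ ((n ∸ suc l) C (i ∸ l)))
  vanishing : ℕ → ℚ
  vanishing l = sgn (suc j ∸ l) * (ℕ→ℚ (n C l) * ℕ→ℚ ((n ∸ l) C (suc j ∸ l)))
  last-term : term (suc j) (suc j) ≡ vanishing (suc j)
  last-term rewrite ℕ.n∸n≡0 j = refl
  pascal : ∀ l → l ≤ j → term (suc j) l ≡ vanishing l + term j l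
  pascal l l≤j = begin
    sgn (suc j ∸ l) * (c * ℕ→ℚ (T C (suc j ∸ l)))
      ≡⟨ cong₂ (λ s k → s * (c * ℕ→ℚ (T C k))) (sgn-suc-∸ l≤j) j+1∸l ⟩
    (- sgn (j ∸ l)) * (c * ℕ→ℚ (T C suc (j ∸ l)))
      ≡⟨ solve 4 (λ s c a b → (:- s) :* (c :* b) := (:- s) :* (c :* (a :+ b)) :+ s :* (c :* a)) refl
           (sgn (j ∸ l)) c (ℕ→ℚ (T C (j ∸ l))) (ℕ→ℚ (T C suc (j ∸ l))) ⟩
    (- sgn (j ∸ l)) * (c * (ℕ→ℚ (T C (j ∸ l)) + ℕ→ℚ (T C suc (j ∸ l)))) + term j l
      ≡⟨ cong (λ x → (- sgn (j ∸ l)) * (c * x) + term j l) (ℕ→ℚ-pascal T (j ∸ l)) ⟩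
    (- sgn (j ∸ l)) * (c * ℕ→ℚ (suc T C suc (j ∸ l))) + term j l
      ≡⟨ cong₂ (λ s k → s * (c * ℕ→ℚ (suc T C k)) + term j l) (sym (sgn-suc-∸ l≤j)) (sym j+1∸l) ⟩
    sgn (suc j ∸ l) * (c * ℕ→ℚ (suc T C (suc j ∸ l))) + term j l
      ≡⟨ cong (λ m → sgn (suc j ∸ l) * (c * ℕ→ℚ (m C (suc j ∸ l))) + term j l) (sym n∸l≡1+T) ⟩
    vanishing l + term j l ∎
    where
    c = ℕ→ℚ (n C l)
    T = n ∸ suc l
    j+1∸l : suc j ∸ l ≡ suc (j ∸ l)
    j+1∸l = ℕ.+-∸-assoc 1 l≤j
    n∸l≡1+T : n ∸ l ≡ suc T
    n∸l≡1+T = n<m⇒m∸n≡suc[m∸suc[n]] (ℕ.≤-<-trans l≤j (ℕ.<-trans (ℕ.n<1+n j) 1+j<n))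

Σ<-sgn*C*inv≡inv : ∀ n j → j < n →
  Σ< (suc j) (λ l → sgn (j ∸ l) * (ℕ→ℚ ((n ∸ l) C (n ∸ j)) * ℕ→ℚ (n C l) * inv (n ∸ l))) ≡ inv (n ∸ j)
Σ<-sgn*C*inv≡inv n j j<n = begin
  Σ< (suc j) (λ l → sgn (j ∸ l) * (ℕ→ℚ ((n ∸ l) C (n ∸ j)) * ℕ→ℚ (n C l) * inv (n ∸ l)))
    ≡⟨ Σ<-cong (suc j) (λ l l<1+j → absorb l (ℕ.≤-pred l<1+j)) ⟩
  Σ< (suc j) (λ l → inv (n ∸ j) * (sgn (j ∸ l) * (ℕ→ℚ (n C l) * ℕ→ℚ ((n ∸ suc l) C (j ∸ l)))))
    ≡⟨ sym (*-distribˡ-Σ< (suc j) (inv (n ∸ j)) _) ⟩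
  inv (n ∸ j) * Σ< (suc j) (λ l → sgn (j ∸ l) * (ℕ→ℚ (n C l) * ℕ→ℚ ((n ∸ suc l) C (j ∸ l))))
    ≡⟨ cong (inv (n ∸ j) *_) (Σ<-sgn*C*C≡1 n j j<n) ⟩
  inv (n ∸ j) * 1ℚ
    ≡⟨ *-identityʳ (inv (n ∸ j)) ⟩
  inv (n ∸ j) ∎
  where
  absorb : ∀ l → l ≤ j → sgn (j ∸ l) * (ℕ→ℚ ((n ∸ l) C (n ∸ j)) * ℕ→ℚ (n C l) * inv (n ∸ l))
                         ≡ inv (n ∸ j) * (sgn (j ∸ l) * (ℕ→ℚ (n C l) * ℕ→ℚ ((n ∸ suc l) C (j ∸ l))))
  absorb l l≤j = begin
    s * (ℕ→ℚ ((n ∸ l) C (n ∸ j)) * c * inv (n ∸ l))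
      ≡⟨ solve 4 (λ s x c i → s :* (x :* c :* i) := s :* c :* (x :* i)) refl s (ℕ→ℚ ((n ∸ l) C (n ∸ j))) c (inv (n ∸ l)) ⟩
    s * c * (ℕ→ℚ ((n ∸ l) C (n ∸ j)) * inv (n ∸ l))
      ≡⟨ cong (s * c *_) (ℕ→ℚ-absorption-∸ l≤j j<n) ⟩
    s * c * (inv (n ∸ j) * ℕ→ℚ ((n ∸ suc l) C (j ∸ l)))
      ≡⟨ solve 4 (λ s c i x → s :* c :* (i :* x) := i :* (s :* (c :* x))) refl s c (inv (n ∸ j)) (ℕ→ℚ ((n ∸ suc l) C (j ∸ l))) ⟩
    inv (n ∸ j) * (s * (c * ℕ→ℚ ((n ∸ suc l) C (j ∸ l)))) ∎
    where
    s = sgn (j ∸ l)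
    c = ℕ→ℚ (n C l)

Σ<-sgn*C*inv≡H-H : ∀ n j → j ≤ n →
  Σ< j (λ l → sgn (j ∸ suc l) * (ℕ→ℚ ((n ∸ suc l) C (n ∸ j)) * ℕ→ℚ (n C l) * inv (n ∸ l))) ≡ H n - H (n ∸ j)
Σ<-sgn*C*inv≡H-H n zero    _      = sym (+-inverseʳ (H n))
Σ<-sgn*C*inv≡H-H n (suc j) 1+j≤n = begin
  Σ< (suc j) (λ l → sgn (j ∸ l) * (ℕ→ℚ ((n ∸ suc l) C M) * ℕ→ℚ (n C l) * inv (n ∸ l)))
    ≡⟨ Σ<-cong (suc j) (λ l l<1+j → pascal l (ℕ.≤-pred l<1+j)) ⟩
  Σ< (suc j) (λ l → sgn (j ∸ l) * (ℕ→ℚ ((n ∸ l) C (n ∸ j)) * ℕ→ℚ (n C l) * inv (n ∸ l)) - sgn (j ∸ l) * B l)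
    ≡⟨ Σ<-distrib-- (suc j) _ _ ⟩
  Σ< (suc j) (λ l → sgn (j ∸ l) * (ℕ→ℚ ((n ∸ l) C (n ∸ j)) * ℕ→ℚ (n C l) * inv (n ∸ l))) - Σ< (suc j) (λ l → sgn (j ∸ l) * B l)
    ≡⟨ cong₂ _-_ (Σ<-sgn*C*inv≡inv n j 1+j≤n) (Σ<-suc-vanishing j _ last-term-vanishes) ⟩
  inv (n ∸ j) - Σ< j (λ l → sgn (j ∸ l) * B l)
    ≡⟨ cong (λ x → inv (n ∸ j) - x) (Σ<-sgn-flip j B) ⟩
  inv (n ∸ j) - - Σ< j (λ l → sgn (j ∸ suc l) * B l)
    ≡⟨ cong (λ x → inv (n ∸ j) - - x) (Σ<-sgn*C*inv≡H-H n j (ℕ.<⇒≤ 1+j≤n)) ⟩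
  inv (n ∸ j) - - (H n - H (n ∸ j))
    ≡⟨ cong (λ m → inv m - - (H n - H m)) n∸j≡1+M ⟩
  inv (suc M) - - (H n - (H M + inv (suc M)))
    ≡⟨ solve 3 (λ i a b → i :- :- (a :- (b :+ i)) := a :- b) refl (inv (suc M)) (H n) (H M) ⟩
  H n - H M ∎
  where
  M = n ∸ suc j
  n∸j≡1+M : n ∸ j ≡ suc M
  n∸j≡1+M = n<m⇒m∸n≡suc[m∸suc[n]] 1+j≤n
  B : ℕ → ℚ
  B l = ℕ→ℚ ((n ∸ suc l) C (n ∸ j)) * ℕ→ℚ (n C l) * inv (n ∸ l)
  last-term-vanishes : sgn (j ∸ j) * B j ≡ 0ℚ
  last-term-vanishes = begin
    sgn (j ∸ j) * (ℕ→ℚ (M C (n ∸ j)) * ℕ→ℚ (n C j) * inv (n ∸ j))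
      ≡⟨ cong (λ k → sgn (j ∸ j) * (ℕ→ℚ k * ℕ→ℚ (n C j) * inv (n ∸ j))) M-choose-[n∸j]≡0 ⟩
    sgn (j ∸ j) * (0ℚ * ℕ→ℚ (n C j) * inv (n ∸ j))
      ≡⟨ solve 3 (λ s c i → s :* (con 0ℚ :* c :* i) := con 0ℚ) refl (sgn (j ∸ j)) (ℕ→ℚ (n C j)) (inv (n ∸ j)) ⟩
    0ℚ ∎
    where
    M-choose-[n∸j]≡0 : M C (n ∸ j) ≡ 0
    M-choose-[n∸j]≡0 = trans (cong (M C_) n∸j≡1+M) (k>n⇒nCk≡0 (ℕ.n<1+n M))
  pascal : ∀ l → l ≤ j →
    sgn (j ∸ l) * (ℕ→ℚ ((n ∸ suc l) C M) * ℕ→ℚ (n C l) * inv (n ∸ l))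
    ≡ sgn (j ∸ l) * (ℕ→ℚ ((n ∸ l) C (n ∸ j)) * ℕ→ℚ (n C l) * inv (n ∸ l)) - sgn (j ∸ l) * B l
  pascal l l≤j = begin
    s * (ℕ→ℚ (T C M) * c * i)
      ≡⟨ solve 5 (λ s a b c i → s :* (a :* c :* i) := s :* ((a :+ b) :* c :* i) :- s :* (b :* c :* i)) refl
           s (ℕ→ℚ (T C M)) (ℕ→ℚ (T C (n ∸ j))) c i ⟩
    s * ((ℕ→ℚ (T C M) + ℕ→ℚ (T C (n ∸ j))) * c * i) - s * B l
      ≡⟨ cong (λ x → s * (x * c * i) - s * B l) pascal-∸ ⟩
    s * (ℕ→ℚ ((n ∸ l) C (n ∸ j)) * c * i) - s * B l ∎
    where
    s = sgn (j ∸ l)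
    c = ℕ→ℚ (n C l)
    i = inv (n ∸ l)
    T = n ∸ suc l
    n∸l≡1+T : n ∸ l ≡ suc T
    n∸l≡1+T = n<m⇒m∸n≡suc[m∸suc[n]] (ℕ.≤-<-trans l≤j 1+j≤n)
    pascal-∸ : ℕ→ℚ (T C M) + ℕ→ℚ (T C (n ∸ j)) ≡ ℕ→ℚ ((n ∸ l) C (n ∸ j))
    pascal-∸ = begin
      ℕ→ℚ (T C M) + ℕ→ℚ (T C (n ∸ j))  ≡⟨ cong (λ k → ℕ→ℚ (T C M) + ℕ→ℚ (T C k)) n∸j≡1+M ⟩
      ℕ→ℚ (T C M) + ℕ→ℚ (T C suc M)    ≡⟨ ℕ→ℚ-pascal T M ⟩
      ℕ→ℚ (suc T C suc M)              ≡⟨ cong₂ (λ a b → ℕ→ℚ (a C b)) (sym n∸l≡1+T) (sym n∸j≡1+M) ⟩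
      ℕ→ℚ ((n ∸ l) C (n ∸ j))          ∎

-- The Stirling expansion of the falling factorial

stirling1-vanishes : ∀ {j k} → j < k → stirling1 j k ≡ 0
stirling1-vanishes {zero}  {suc k} _         = refl
stirling1-vanishes {suc j} {suc k} (s≤s j<k)
  rewrite stirling1-vanishes (ℕ.m<n⇒m<1+n j<k) | stirling1-vanishes j<k = trans (ℕ.+-identityʳ (j ℕ.* 0)) (ℕ.*-zeroʳ j)

-- the coefficient of x^k in (x)_j
fallingCoeff : ℕ → ℕ → ℚ
fallingCoeff j k = sgn (j ∸ k) * ℕ→ℚ (stirling1 j k)

fallingCoeff-vanishes : ∀ {j k} → j < k → fallingCoeff j k ≡ 0ℚ
fallingCoeff-vanishes {j} {k} j<k =
  trans (cong (λ s → sgn (j ∸ k) * ℕ→ℚ s) (stirling1-vanishes j<k)) (*-zeroʳ (sgn (j ∸ k)))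

j*fallingCoeff[j,0]≡0 : ∀ j → ℕ→ℚ j * fallingCoeff j 0 ≡ 0ℚ
j*fallingCoeff[j,0]≡0 zero    = *-zeroˡ (fallingCoeff 0 0)
j*fallingCoeff[j,0]≡0 (suc j) = trans (cong (ℕ→ℚ (suc j) *_) (*-zeroʳ (sgn (suc j)))) (*-zeroʳ (ℕ→ℚ (suc j)))

-- holds for all k, since for k ≥ j both sides vanish
sgn[j∸k]*stirling1[j,1+k] : ∀ j k → sgn (j ∸ k) * ℕ→ℚ (stirling1 j (suc k)) ≡ - fallingCoeff j (suc k)
sgn[j∸k]*stirling1[j,1+k] j k with k ℕ.<? j
... | yes k<j = trans (cong (λ m → sgn m * ℕ→ℚ (stirling1 j (suc k))) (n<m⇒m∸n≡suc[m∸suc[n]] k<j))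
                      (sym (neg-distribˡ-* (sgn (j ∸ suc k)) (ℕ→ℚ (stirling1 j (suc k)))))
... | no  k≮j rewrite stirling1-vanishes (s≤s (ℕ.≮⇒≥ k≮j)) =
  trans (*-zeroʳ (sgn (j ∸ k))) (sym (cong -_ (*-zeroʳ (sgn (j ∸ suc k)))))

fallingCoeff-suc : ∀ j k → fallingCoeff (suc j) (suc k) ≡ fallingCoeff j k - ℕ→ℚ j * fallingCoeff j (suc k)
fallingCoeff-suc j k = begin
  sgn (j ∸ k) * ℕ→ℚ (j ℕ.* stirling1 j (suc k) ℕ.+ stirling1 j k)
    ≡⟨ cong (sgn (j ∸ k) *_) (trans (ℕ→ℚ-+ (j ℕ.* stirling1 j (suc k)) (stirling1 j k)) (cong (_+ ℕ→ℚ (stirling1 j k)) (ℕ→ℚ-* j (stirling1 j (suc k))))) ⟩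
  sgn (j ∸ k) * (ℕ→ℚ j * ℕ→ℚ (stirling1 j (suc k)) + ℕ→ℚ (stirling1 j k))
    ≡⟨ solve 4 (λ s a b c → s :* (a :* b :+ c) := s :* c :+ a :* (s :* b)) refl
         (sgn (j ∸ k)) (ℕ→ℚ j) (ℕ→ℚ (stirling1 j (suc k))) (ℕ→ℚ (stirling1 j k)) ⟩
  fallingCoeff j k + ℕ→ℚ j * (sgn (j ∸ k) * ℕ→ℚ (stirling1 j (suc k)))
    ≡⟨ cong (λ x → fallingCoeff j k + ℕ→ℚ j * x) (sgn[j∸k]*stirling1[j,1+k] j k) ⟩
  fallingCoeff j k + ℕ→ℚ j * - fallingCoeff j (suc k)
    ≡⟨ solve 3 (λ a b c → a :+ b :* (:- c) := a :- b :* c) refl (fallingCoeff j k) (ℕ→ℚ j) (fallingCoeff j (suc k)) ⟩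
  fallingCoeff j k - ℕ→ℚ j * fallingCoeff j (suc k) ∎

-- Σ_{k ≤ j} (-1)^{j-k} [j k] x^k and its derivative in x, both evaluated at x = n
fallingPoly : ℕ → ℕ → ℚ
fallingPoly n j = Σ< (suc j) (λ k → fallingCoeff j k * ℕ→ℚ (n ^ k))

fallingPoly′ : ℕ → ℕ → ℚ
fallingPoly′ n j = Σ< j (λ k → ℕ→ℚ (suc k) * fallingCoeff j (suc k) * ℕ→ℚ (n ^ k))

fallingPoly-sucˡ : ∀ n j →
  fallingPoly n j ≡ fallingCoeff j 0 + Σ< (suc j) (λ k → fallingCoeff j (suc k) * ℕ→ℚ (n ^ suc k))
fallingPoly-sucˡ n j = begin
  fallingPoly n j
    ≡⟨ Σ<-sucˡ j _ ⟩
  fallingCoeff j 0 * 1ℚ + Σ< j (λ k → fallingCoeff j (suc k) * ℕ→ℚ (n ^ suc k))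
    ≡⟨ cong₂ _+_ (*-identityʳ (fallingCoeff j 0)) (sym (Σ<-suc-vanishing j _ top-vanishes)) ⟩
  fallingCoeff j 0 + Σ< (suc j) (λ k → fallingCoeff j (suc k) * ℕ→ℚ (n ^ suc k)) ∎
  where
  top-vanishes : fallingCoeff j (suc j) * ℕ→ℚ (n ^ suc j) ≡ 0ℚ
  top-vanishes = trans (cong (_* ℕ→ℚ (n ^ suc j)) (fallingCoeff-vanishes (ℕ.n<1+n j))) (*-zeroˡ (ℕ→ℚ (n ^ suc j)))

fallingPoly-suc : ∀ n j → fallingPoly n (suc j) ≡ (ℕ→ℚ n - ℕ→ℚ j) * fallingPoly n j
fallingPoly-suc n j = begin
  fallingPoly n (suc j)
    ≡⟨ Σ<-sucˡ (suc j) _ ⟩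
  fallingCoeff (suc j) 0 * 1ℚ + Σ< (suc j) (λ k → fallingCoeff (suc j) (suc k) * X (suc k))
    ≡⟨ cong₂ _+_ (trans (*-identityʳ _) (*-zeroʳ (sgn (suc j)))) (Σ<-cong (suc j) (λ k _ → step k)) ⟩
  0ℚ + Σ< (suc j) (λ k → x * (fallingCoeff j k * X k) - ℕ→ℚ j * (fallingCoeff j (suc k) * X (suc k)))
    ≡⟨ trans (+-identityˡ _) (Σ<-distrib-- (suc j) _ _) ⟩
  Σ< (suc j) (λ k → x * (fallingCoeff j k * X k)) - Σ< (suc j) (λ k → ℕ→ℚ j * (fallingCoeff j (suc k) * X (suc k)))
    ≡⟨ cong₂ _-_ (sym (*-distribˡ-Σ< (suc j) x _)) (sym (*-distribˡ-Σ< (suc j) (ℕ→ℚ j) _)) ⟩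
  x * P - ℕ→ℚ j * S
    ≡⟨ solve 4 (λ x q p s → x :* p :- q :* s := (x :- q) :* p :+ q :* (p :- s)) refl x (ℕ→ℚ j) P S ⟩
  (x - ℕ→ℚ j) * P + ℕ→ℚ j * (P - S)
    ≡⟨ cong (λ t → (x - ℕ→ℚ j) * P + ℕ→ℚ j * t) P-S≡fallingCoeff[j,0] ⟩
  (x - ℕ→ℚ j) * P + ℕ→ℚ j * fallingCoeff j 0
    ≡⟨ trans (cong (_+_ ((x - ℕ→ℚ j) * P)) (j*fallingCoeff[j,0]≡0 j)) (+-identityʳ _) ⟩
  (x - ℕ→ℚ j) * P ∎
  where
  x = ℕ→ℚ n
  X : ℕ → ℚ
  X k = ℕ→ℚ (n ^ k)
  P = fallingPoly n j
  S = Σ< (suc j) (λ k → fallingCoeff j (suc k) * X (suc k))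
  P-S≡fallingCoeff[j,0] : P - S ≡ fallingCoeff j 0
  P-S≡fallingCoeff[j,0] = trans (cong (_- S) (fallingPoly-sucˡ n j)) (solve 2 (λ c s → c :+ s :- s := c) refl (fallingCoeff j 0) S)
  step : ∀ k → fallingCoeff (suc j) (suc k) * X (suc k) ≡ x * (fallingCoeff j k * X k) - ℕ→ℚ j * (fallingCoeff j (suc k) * X (suc k))
  step k = begin
    fallingCoeff (suc j) (suc k) * X (suc k)
      ≡⟨ cong₂ _*_ (fallingCoeff-suc j k) (ℕ→ℚ-* n (n ^ k)) ⟩
    (fallingCoeff j k - ℕ→ℚ j * fallingCoeff j (suc k)) * (x * X k)
      ≡⟨ solve 5 (λ a q b x y → (a :- q :* b) :* (x :* y) := x :* (a :* y) :- q :* (b :* (x :* y))) refl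
           (fallingCoeff j k) (ℕ→ℚ j) (fallingCoeff j (suc k)) x (X k) ⟩
    x * (fallingCoeff j k * X k) - ℕ→ℚ j * (fallingCoeff j (suc k) * (x * X k))
      ≡⟨ cong (λ y → x * (fallingCoeff j k * X k) - ℕ→ℚ j * (fallingCoeff j (suc k) * y)) (sym (ℕ→ℚ-* n (n ^ k))) ⟩
    x * (fallingCoeff j k * X k) - ℕ→ℚ j * (fallingCoeff j (suc k) * X (suc k)) ∎

fallingPoly′-euler : ∀ n j →
  Σ< (suc j) (λ k → ℕ→ℚ k * fallingCoeff j k * ℕ→ℚ (n ^ k)) ≡ ℕ→ℚ n * fallingPoly′ n j
fallingPoly′-euler n j = begin
  Σ< (suc j) (λ k → ℕ→ℚ k * fallingCoeff j k * ℕ→ℚ (n ^ k))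
    ≡⟨ Σ<-sucˡ j _ ⟩
  0ℚ * fallingCoeff j 0 * 1ℚ + Σ< j (λ k → ℕ→ℚ (suc k) * fallingCoeff j (suc k) * ℕ→ℚ (n ℕ.* n ^ k))
    ≡⟨ cong₂ _+_ (trans (cong (_* 1ℚ) (*-zeroˡ (fallingCoeff j 0))) (*-zeroˡ 1ℚ)) (Σ<-cong j (λ k _ → step k)) ⟩
  0ℚ + Σ< j (λ k → ℕ→ℚ n * (ℕ→ℚ (suc k) * fallingCoeff j (suc k) * ℕ→ℚ (n ^ k)))
    ≡⟨ trans (+-identityˡ _) (sym (*-distribˡ-Σ< j (ℕ→ℚ n) _)) ⟩
  ℕ→ℚ n * fallingPoly′ n j ∎
  where
  step : ∀ k → ℕ→ℚ (suc k) * fallingCoeff j (suc k) * ℕ→ℚ (n ℕ.* n ^ k)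
             ≡ ℕ→ℚ n * (ℕ→ℚ (suc k) * fallingCoeff j (suc k) * ℕ→ℚ (n ^ k))
  step k = trans (cong (ℕ→ℚ (suc k) * fallingCoeff j (suc k) *_) (ℕ→ℚ-* n (n ^ k)))
                 (solve 4 (λ a b x y → a :* b :* (x :* y) := x :* (a :* b :* y)) refl
                   (ℕ→ℚ (suc k)) (fallingCoeff j (suc k)) (ℕ→ℚ n) (ℕ→ℚ (n ^ k)))

fallingPoly′-suc : ∀ n j → fallingPoly′ n (suc j) ≡ (ℕ→ℚ n - ℕ→ℚ j) * fallingPoly′ n j + fallingPoly n j
fallingPoly′-suc n j = begin
  fallingPoly′ n (suc j)
    ≡⟨ Σ<-cong (suc j) (λ k _ → step k) ⟩
  Σ< (suc j) (λ k → (c k * X k + ℕ→ℚ k * c k * X k) - ℕ→ℚ j * d k)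
    ≡⟨ Σ<-distrib-- (suc j) _ _ ⟩
  Σ< (suc j) (λ k → c k * X k + ℕ→ℚ k * c k * X k) - Σ< (suc j) (λ k → ℕ→ℚ j * d k)
    ≡⟨ cong₂ _-_ (Σ<-distrib-+ (suc j) _ _) (sym (*-distribˡ-Σ< (suc j) (ℕ→ℚ j) d)) ⟩
  (fallingPoly n j + Σ< (suc j) (λ k → ℕ→ℚ k * c k * X k)) - ℕ→ℚ j * Σ< (suc j) d
    ≡⟨ cong₂ (λ a b → (fallingPoly n j + a) - ℕ→ℚ j * b) (fallingPoly′-euler n j) (Σ<-suc-vanishing j d top-vanishes) ⟩
  (fallingPoly n j + ℕ→ℚ n * fallingPoly′ n j) - ℕ→ℚ j * fallingPoly′ n j
    ≡⟨ solve 4 (λ p x d q → (p :+ x :* d) :- q :* d := (x :- q) :* d :+ p) refl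
         (fallingPoly n j) (ℕ→ℚ n) (fallingPoly′ n j) (ℕ→ℚ j) ⟩
  (ℕ→ℚ n - ℕ→ℚ j) * fallingPoly′ n j + fallingPoly n j ∎
  where
  c = fallingCoeff j
  X : ℕ → ℚ
  X k = ℕ→ℚ (n ^ k)
  d : ℕ → ℚ
  d k = ℕ→ℚ (suc k) * c (suc k) * X k
  top-vanishes : d j ≡ 0ℚ
  top-vanishes = trans (cong (λ y → ℕ→ℚ (suc j) * y * X j) (fallingCoeff-vanishes (ℕ.n<1+n j)))
                       (solve 2 (λ a y → a :* con 0ℚ :* y := con 0ℚ) refl (ℕ→ℚ (suc j)) (X j))
  step : ∀ k → ℕ→ℚ (suc k) * fallingCoeff (suc j) (suc k) * X k ≡ (c k * X k + ℕ→ℚ k * c k * X k) - ℕ→ℚ j * d k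
  step k = begin
    ℕ→ℚ (suc k) * fallingCoeff (suc j) (suc k) * X k
      ≡⟨ cong₂ (λ s y → s * y * X k) (ℕ→ℚ-+ 1 k) (fallingCoeff-suc j k) ⟩
    (1ℚ + ℕ→ℚ k) * (c k - ℕ→ℚ j * c (suc k)) * X k
      ≡⟨ solve 5 (λ m a q b y → (con 1ℚ :+ m) :* (a :- q :* b) :* y := (a :* y :+ m :* a :* y) :- q :* ((con 1ℚ :+ m) :* b :* y)) refl
           (ℕ→ℚ k) (c k) (ℕ→ℚ j) (c (suc k)) (X k) ⟩
    (c k * X k + ℕ→ℚ k * c k * X k) - ℕ→ℚ j * ((1ℚ + ℕ→ℚ k) * c (suc k) * X k)
      ≡⟨ cong (λ s → (c k * X k + ℕ→ℚ k * c k * X k) - ℕ→ℚ j * (s * c (suc k) * X k)) (sym (ℕ→ℚ-+ 1 k)) ⟩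
    (c k * X k + ℕ→ℚ k * c k * X k) - ℕ→ℚ j * d k ∎

ℕ→ℚ-falling : ∀ n j → j ≤ n → ℕ→ℚ (falling n j) ≡ fallingPoly n j
ℕ→ℚ-falling n zero    _     = refl
ℕ→ℚ-falling n (suc j) 1+j≤n = begin
  ℕ→ℚ (falling n j ℕ.* (n ∸ j))          ≡⟨ ℕ→ℚ-* (falling n j) (n ∸ j) ⟩
  ℕ→ℚ (falling n j) * ℕ→ℚ (n ∸ j)        ≡⟨ cong₂ _*_ (ℕ→ℚ-falling n j (ℕ.<⇒≤ 1+j≤n)) (ℕ→ℚ-∸ (ℕ.<⇒≤ 1+j≤n)) ⟩
  fallingPoly n j * (ℕ→ℚ n - ℕ→ℚ j)       ≡⟨ *-comm (fallingPoly n j) (ℕ→ℚ n - ℕ→ℚ j) ⟩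
  (ℕ→ℚ n - ℕ→ℚ j) * fallingPoly n j       ≡⟨ sym (fallingPoly-suc n j) ⟩
  fallingPoly n (suc j)                   ∎

falling-pos : ∀ n j → j ≤ n → 0 < falling n j
falling-pos n zero    _     = s≤s z≤n
falling-pos n (suc j) 1+j≤n = ℕ.>-nonZero⁻¹ _
  {{ℕ.m*n≢0 (falling n j) (n ∸ j) {{ℕ.>-nonZero (falling-pos n j (ℕ.<⇒≤ 1+j≤n))}} {{ℕ.>-nonZero (ℕ.m<n⇒0<n∸m 1+j≤n)}}}}

[H-H]*falling≡fallingPoly′ : ∀ n j → j ≤ n → (H n - H (n ∸ j)) * ℕ→ℚ (falling n j) ≡ fallingPoly′ n j
[H-H]*falling≡fallingPoly′ n zero    _     = trans (cong (_* 1ℚ) (+-inverseʳ (H n))) (*-zeroˡ 1ℚ)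
[H-H]*falling≡fallingPoly′ n (suc j) 1+j≤n = begin
  (H n - H M) * ℕ→ℚ (falling n j ℕ.* (n ∸ j))
    ≡⟨ cong ((H n - H M) *_) (trans (ℕ→ℚ-* (falling n j) (n ∸ j)) (cong (λ m → F * ℕ→ℚ m) n∸j≡1+M)) ⟩
  (H n - H M) * (F * ℕ→ℚ (suc M))
    ≡⟨ solve 5 (λ a b i f s → (a :- b) :* (f :* s) := (a :- (b :+ i)) :* f :* s :+ i :* s :* f) refl
         (H n) (H M) (inv (suc M)) F (ℕ→ℚ (suc M)) ⟩
  (H n - H (suc M)) * F * ℕ→ℚ (suc M) + inv (suc M) * ℕ→ℚ (suc M) * F
    ≡⟨ cong₂ (λ a b → a * ℕ→ℚ (suc M) + b * F) IH (inv-inverseˡ M) ⟩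
  fallingPoly′ n j * ℕ→ℚ (suc M) + 1ℚ * F
    ≡⟨ cong₂ (λ a b → fallingPoly′ n j * a + b) 1+M≡n-j (trans (*-identityˡ F) (ℕ→ℚ-falling n j j≤n)) ⟩
  fallingPoly′ n j * (ℕ→ℚ n - ℕ→ℚ j) + fallingPoly n j
    ≡⟨ cong (_+ fallingPoly n j) (*-comm (fallingPoly′ n j) (ℕ→ℚ n - ℕ→ℚ j)) ⟩
  (ℕ→ℚ n - ℕ→ℚ j) * fallingPoly′ n j + fallingPoly n j
    ≡⟨ sym (fallingPoly′-suc n j) ⟩
  fallingPoly′ n (suc j) ∎
  where
  M = n ∸ suc j
  F = ℕ→ℚ (falling n j)
  j≤n : j ≤ n
  j≤n = ℕ.<⇒≤ 1+j≤n
  n∸j≡1+M : n ∸ j ≡ suc M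
  n∸j≡1+M = n<m⇒m∸n≡suc[m∸suc[n]] 1+j≤n
  1+M≡n-j : ℕ→ℚ (suc M) ≡ ℕ→ℚ n - ℕ→ℚ j
  1+M≡n-j = trans (cong ℕ→ℚ (sym n∸j≡1+M)) (ℕ→ℚ-∸ j≤n)
  IH : (H n - H (suc M)) * F ≡ fallingPoly′ n j
  IH = subst (λ m → (H n - H m) * F ≡ fallingPoly′ n j) n∸j≡1+M ([H-H]*falling≡fallingPoly′ n j j≤n)

lemma5 : (n j : ℕ) → 1 ≤ j → j ≤ n →
    (Σ< j (λ l → sgn (j ∸ l ∸ 1) * ℕ→ℚ ((n ∸ l ∸ 1) C (n ∸ j)) * ℕ→ℚ (n C l) * inv (n ∸ l))
    ≡ H n - H (n ∸ j))
    × (H n - H (n ∸ j)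
    ≡ inv (falling n j) * Σ< j (λ ν → sgn (j ∸ ν ∸ 1) * ℕ→ℚ (ℕ.suc ν) * ℕ→ℚ (stirling1 j (ℕ.suc ν)) * ℕ→ℚ (n ^ ν)))
lemma5 n j _ j≤n =
    trans (Σ<-cong j (λ l _ → binomial-term l)) (Σ<-sgn*C*inv≡H-H n j j≤n)
  , trans (p*k≡q⇒p≡inv[k]*q _ _ (falling-pos n j j≤n) ([H-H]*falling≡fallingPoly′ n j j≤n))
          (cong (inv (falling n j) *_) (Σ<-cong j (λ ν _ → stirling-term ν)))
  where
  binomial-term : ∀ l → sgn (j ∸ l ∸ 1) * ℕ→ℚ ((n ∸ l ∸ 1) C (n ∸ j)) * ℕ→ℚ (n C l) * inv (n ∸ l)
                      ≡ sgn (j ∸ suc l) * (ℕ→ℚ ((n ∸ suc l) C (n ∸ j)) * ℕ→ℚ (n C l) * inv (n ∸ l))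
  binomial-term l = begin
    sgn (j ∸ l ∸ 1) * ℕ→ℚ ((n ∸ l ∸ 1) C (n ∸ j)) * ℕ→ℚ (n C l) * inv (n ∸ l)
      ≡⟨ cong₂ (λ a b → sgn a * ℕ→ℚ (b C (n ∸ j)) * ℕ→ℚ (n C l) * inv (n ∸ l)) (m∸n∸1≡m∸suc[n] j l) (m∸n∸1≡m∸suc[n] n l) ⟩
    sgn (j ∸ suc l) * ℕ→ℚ ((n ∸ suc l) C (n ∸ j)) * ℕ→ℚ (n C l) * inv (n ∸ l)
      ≡⟨ solve 4 (λ s a b c → s :* a :* b :* c := s :* (a :* b :* c)) refl
           (sgn (j ∸ suc l)) (ℕ→ℚ ((n ∸ suc l) C (n ∸ j))) (ℕ→ℚ (n C l)) (inv (n ∸ l)) ⟩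
    sgn (j ∸ suc l) * (ℕ→ℚ ((n ∸ suc l) C (n ∸ j)) * ℕ→ℚ (n C l) * inv (n ∸ l)) ∎
  stirling-term : ∀ ν → ℕ→ℚ (suc ν) * fallingCoeff j (suc ν) * ℕ→ℚ (n ^ ν)
                      ≡ sgn (j ∸ ν ∸ 1) * ℕ→ℚ (suc ν) * ℕ→ℚ (stirling1 j (suc ν)) * ℕ→ℚ (n ^ ν)
  stirling-term ν = begin
    ℕ→ℚ (suc ν) * (sgn (j ∸ suc ν) * ℕ→ℚ (stirling1 j (suc ν))) * ℕ→ℚ (n ^ ν)
      ≡⟨ solve 4 (λ a s b c → a :* (s :* b) :* c := s :* a :* b :* c) refl
           (ℕ→ℚ (suc ν)) (sgn (j ∸ suc ν)) (ℕ→ℚ (stirling1 j (suc ν))) (ℕ→ℚ (n ^ ν)) ⟩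
    sgn (j ∸ suc ν) * ℕ→ℚ (suc ν) * ℕ→ℚ (stirling1 j (suc ν)) * ℕ→ℚ (n ^ ν)
      ≡⟨ cong (λ a → sgn a * ℕ→ℚ (suc ν) * ℕ→ℚ (stirling1 j (suc ν)) * ℕ→ℚ (n ^ ν)) (sym (m∸n∸1≡m∸suc[n] j ν)) ⟩
    sgn (j ∸ ν ∸ 1) * ℕ→ℚ (suc ν) * ℕ→ℚ (stirling1 j (suc ν)) * ℕ→ℚ (n ^ ν) ∎
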